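{- Let $n,k$ be integers with $8\le 2k\le n-2$, and let $\lambda\in\overline{\mathcal{U}}_{T_{n,n-2k+1}}$ with largest part $2n-4$. Then the Keith--Nath Young diagram $Y_{S_\lambda}$ has exactly $2n-4+2k$ cells; consequently the sum of the hook lengths along its main diagonal is $2n-4+2k$.
   Context: Partitions into distinct parts: $\lambda=(\lambda_1<\dots<\lambda_t)$, $t\ge2$. Missing parts $\mathcal{M}_\lambda=\{1,\dots,\lambda_t\}\setminus\{\lambda_i\}$. Unrefinable: no two distinct missing parts sum to a part. Maximal: largest part is maximum among unrefinable partitions of the same integer. $\overline{\mathcal{U}}_N$: maximal unrefinable partitions of $N$ with $\#\mathcal{M}_\lambda=\lfloor\lambda_t/2\rfloor$. $T_n=n(n+1)/2$, $T_{n,d}=T_n-d$. $S_\lambda=\mathbb{N}_0\setminus\lambda$; $Y_{S_\lambda}$ (English convention) has one row per part $g$ of $\lambda$, ordered top to bottom by decreasing $g$, the row of $g$ having $\#\{s\in S_\lambda:s<g\}$ cells. Hook length = arm + leg + 1. -}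

module Defs where

open import Data.Nat using (ℕ; zero; suc; _+_; _*_; _∸_; _≤_; _<_; _⊔_; _<?_)
open import Data.Nat.Properties using (_≟_)
open import Data.Nat.DivMod using (_/_)
open import Data.Nat.ListAction using (sum)
open import Data.List using (List; []; _∷_; length; filter; upTo; reverse; map; foldr)
open import Data.List.Relation.Unary.All using (All)
open import Data.List.Relation.Unary.Linked using (Linked)
open import Data.List.Membership.Propositional using (_∈_; _∉_)
open import Data.List.Membership.DecPropositional _≟_ using (_∈?_)
open import Data.Product using (_×_)
open import Relation.Binary.PropositionalEquality using (_≡_; _≢_)

open import Relation.Nullary.Decidable using (⌊_⌋; ¬?)
open import Data.Bool using (if_then_else_)

record IsDistinctPartition (λs : List ℕ) : Set where
  field
    increasing : Linked _<_ λs
    positive   : All (0 <_) λs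
    atLeastTwo : 2 ≤ length λs

∣_∣ₚ : List ℕ → ℕ
∣ λs ∣ₚ = sum λs

largest : List ℕ → ℕ
largest = foldr _⊔_ 0

Missing : List ℕ → ℕ → Set
Missing λs m = (1 ≤ m) × (m ≤ largest λs) × (m ∉ λs)

missingParts : List ℕ → List ℕ
missingParts λs = filter (λ m → ¬? (m ∈? λs)) (map suc (upTo (largest λs)))

numMissing : List ℕ → ℕ
numMissing λs = length (missingParts λs)

Unrefinable : List ℕ → Set
Unrefinable λs = ∀ a b → Missing λs a → Missing λs b → a ≢ b → (a + b) ∉ λs

Maximal : List ℕ → Set
Maximal λs = ∀ μ → IsDistinctPartition μ → ∣ μ ∣ₚ ≡ ∣ λs ∣ₚ → Unrefinable μ →
             largest μ ≤ largest λs

InUbar : ℕ → List ℕ → Set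
InUbar N λs = IsDistinctPartition λs × ∣ λs ∣ₚ ≡ N × Unrefinable λs × Maximal λs
              × numMissing λs ≡ largest λs / 2

T : ℕ → ℕ
T n = (n * suc n) / 2

T₂ : ℕ → ℕ → ℕ
T₂ n d = T n ∸ d

-- #{s ∈ S_λ : s < g}, where S_λ = ℕ₀ \ λ
countBelow : List ℕ → ℕ → ℕ
countBelow λs g = length (filter (λ s → ¬? (s ∈? λs)) (upTo g))

-- row lengths of Y_{S_λ}, top to bottom (parts in decreasing order)
rowsY : List ℕ → List ℕ
rowsY λs = map (countBelow λs) (reverse λs)

cells : List ℕ → ℕ
cells = sum

rowsWithCol : ℕ → List ℕ → ℕ
rowsWithCol i rs = length (filter (λ r → i <? r) rs)

-- sum of hook lengths of the diagonal cells (i,i), i = 0,1,…: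
-- hook = arm + leg + 1, arm = r_i - (i+1), leg = #rows below with a cell in column i
diagHookSumFrom : ℕ → List ℕ → ℕ
diagHookSumFrom i [] = 0
diagHookSumFrom i (r ∷ rs) =
  (if ⌊ i <? r ⌋ then (r ∸ suc i) + rowsWithCol i rs + 1 else 0)
  + diagHookSumFrom (suc i) rs

diagHookSum : List ℕ → ℕ
diagHookSum = diagHookSumFrom 0

{-# OPTIONS --safe #-}
module Submission where

-- The row of a part g of λ has g − #{parts below g} cells, so
-- |Y_{S_λ}| = |λ| − (0 + 1 + ⋯ + (t − 1)) for a partition with t parts.
-- Parts and missing parts together fill {1, …, λ_t}; with λ_t = 2n − 4 and
-- #M_λ = λ_t / 2 this forces t = n − 2, and |λ| = T_n − (n − 2k + 1) then
-- leaves 2n − 4 + 2k cells.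
-- The diagonal hooks of a Young diagram partition its cells: the hook at (i, i)
-- is everything of row i and column i outside the first i rows and columns.

open import Defs
open import Data.Nat using (ℕ; zero; suc; _+_; _*_; _∸_; _≤_; _<_; _≥_; _≤′_; ≤′-refl; ≤′-step; s≤s; s≤s⁻¹)
open import Data.Nat.Properties
open import Algebra.Properties.CommutativeSemigroup +-commutativeSemigroup using (interchange; x∙yz≈y∙xz)
open import Data.Nat.DivMod using (_/_; m*n/n≡m)
open import Data.Nat.ListAction using (sum)
open import Data.Nat.ListAction.Properties using (sum-↭)
open import Data.Nat.Tactic.RingSolver using (solve-∀)
open import Data.List using (List; []; _∷_; [_]; _++_; length; filter; upTo; applyUpTo; reverse; map)
open import Data.List.Properties
  using (upTo-∷ʳ; filter-++; length-++; filter-accept; filter-reject; filter-all; filter-none;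
         map-upTo; map-cong; map-id; reverse-map; unfold-reverse)
open import Data.List.Membership.Propositional using (_∈_; _∉_)
open import Data.List.Membership.DecPropositional _≟_ using (_∈?_)
open import Data.List.Relation.Unary.Any using (here; there)
open import Data.List.Relation.Unary.All as All using (All; []; _∷_)
open import Data.List.Relation.Unary.All.Properties using (All¬⇒¬Any)
open import Data.List.Relation.Unary.AllPairs as AllPairs using (AllPairs; []; _∷_)
import Data.List.Relation.Unary.AllPairs.Properties as AllPairs
open import Data.List.Relation.Unary.Linked using (Linked)
open import Data.List.Relation.Unary.Linked.Properties using (Linked⇒AllPairs)
open import Data.List.Relation.Binary.Permutation.Propositional using (↭-sym)
open import Data.List.Relation.Binary.Permutation.Propositional.Properties using (↭-reverse; All-resp-↭)
open import Data.Product using (_×_; _,_)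
open import Function using (_∘_; flip)
open import Level using (0ℓ)
open import Relation.Binary using (Rel)
open import Relation.Binary.PropositionalEquality using (_≡_; _≢_; refl; sym; trans; cong; cong₂; module ≡-Reasoning)
open import Relation.Nullary using (yes; no; ¬_; contradiction)
open import Relation.Nullary.Decidable using (¬?)
open import Relation.Unary using (Pred; Decidable)

open ≡-Reasoning

AllPairs-reverse⁺ : ∀ {a ℓ} {A : Set a} {R : Rel A ℓ} {xs : List A} →
                    AllPairs R xs → AllPairs (flip R) (reverse xs)
AllPairs-reverse⁺ {xs = []} [] = []
AllPairs-reverse⁺ {xs = x ∷ xs} (x~xs ∷ xs!) rewrite unfold-reverse x xs =
  AllPairs.++⁺ (AllPairs-reverse⁺ xs!) ([] ∷ [])
               (All.map (_∷ []) (All-resp-↭ (↭-sym (↭-reverse xs)) x~xs))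

sum-map-+ : ∀ {a} {A : Set a} (f g : A → ℕ) xs →
            sum (map f xs) + sum (map g xs) ≡ sum (map (λ x → f x + g x) xs)
sum-map-+ f g [] = refl
sum-map-+ f g (x ∷ xs) = begin
  (f x + sum (map f xs)) + (g x + sum (map g xs)) ≡⟨ interchange (f x) _ (g x) _ ⟩
  (f x + g x) + (sum (map f xs) + sum (map g xs)) ≡⟨ cong (f x + g x +_) (sum-map-+ f g xs) ⟩
  (f x + g x) + sum (map (λ x → f x + g x) xs)    ∎

module _ {P : Pred ℕ 0ℓ} (P? : Decidable P) where

  length-filter-upTo-suc : ∀ g → length (filter P? (upTo (suc g))) ≡
                                 length (filter P? (upTo g)) + length (filter P? [ g ])
  length-filter-upTo-suc g = begin
    length (filter P? (upTo (suc g)))                      ≡⟨ cong (length ∘ filter P?) (upTo-∷ʳ g) ⟨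
    length (filter P? (upTo g ++ [ g ]))                   ≡⟨ cong length (filter-++ P? (upTo g) [ g ]) ⟩
    length (filter P? (upTo g) ++ filter P? [ g ])         ≡⟨ length-++ (filter P? (upTo g)) ⟩
    length (filter P? (upTo g)) + length (filter P? [ g ]) ∎

  length-filter-upTo-suc-accept : ∀ {g} → P g →
    length (filter P? (upTo (suc g))) ≡ suc (length (filter P? (upTo g)))
  length-filter-upTo-suc-accept {g} Pg = begin
    length (filter P? (upTo (suc g)))       ≡⟨ length-filter-upTo-suc g ⟩
    length (filter P? (upTo g)) + length (filter P? [ g ])
      ≡⟨ cong (λ ys → length (filter P? (upTo g)) + length ys) (filter-accept P? Pg) ⟩
    length (filter P? (upTo g)) + 1         ≡⟨ +-comm _ 1 ⟩
    suc (length (filter P? (upTo g)))       ∎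

  length-filter-upTo-suc-reject : ∀ {g} → ¬ P g →
    length (filter P? (upTo (suc g))) ≡ length (filter P? (upTo g))
  length-filter-upTo-suc-reject {g} ¬Pg = begin
    length (filter P? (upTo (suc g)))       ≡⟨ length-filter-upTo-suc g ⟩
    length (filter P? (upTo g)) + length (filter P? [ g ])
      ≡⟨ cong (λ ys → length (filter P? (upTo g)) + length ys) (filter-reject P? ¬Pg) ⟩
    length (filter P? (upTo g)) + 0         ≡⟨ +-identityʳ _ ⟩
    length (filter P? (upTo g))             ∎

  length-filter-upTo-mono : ∀ {g h} → g ≤ h → length (filter P? (upTo g)) ≤ length (filter P? (upTo h))
  length-filter-upTo-mono = go ∘ ≤⇒≤′
    where
    go : ∀ {g h} → g ≤′ h → length (filter P? (upTo g)) ≤ length (filter P? (upTo h))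
    go ≤′-refl = ≤-refl
    go {h = suc h} (≤′-step g≤′h) =
      ≤-trans (go g≤′h) (≤-trans (m≤m+n _ _) (≤-reflexive (sym (length-filter-upTo-suc h))))

countBelow-mono : ∀ λs {g h} → g ≤ h → countBelow λs g ≤ countBelow λs h
countBelow-mono λs = length-filter-upTo-mono (λ s → ¬? (s ∈? λs))

partsBelow : List ℕ → ℕ → ℕ
partsBelow xs g = length (filter (_<? g) xs)

partsBelow-zero : ∀ xs → partsBelow xs 0 ≡ 0
partsBelow-zero xs = cong length (filter-none (_<? 0) (All.universal (λ _ → n≮0) xs))

partsBelow-least : ∀ {x xs} → All (x <_) xs → partsBelow xs x ≡ 0
partsBelow-least x<xs = cong length (filter-none (_<? _) (All.map <⇒≯ x<xs))

m<1+n∧m≢n⇒m<n : ∀ {m n} → m < suc n → m ≢ n → m < n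
m<1+n∧m≢n⇒m<n m<1+n m≢n = ≤∧≢⇒< (s≤s⁻¹ m<1+n) m≢n

partsBelow-suc-∷ : ∀ {x g} xs p → x ≢ g → partsBelow xs (suc g) ≡ p + partsBelow xs g →
                   partsBelow (x ∷ xs) (suc g) ≡ p + partsBelow (x ∷ xs) g
partsBelow-suc-∷ {x} {g} xs p x≢g step with x <? g
... | yes x<g
  rewrite filter-accept (_<? suc g) {xs = xs} (m<n⇒m<1+n x<g) | filter-accept (_<? g) {xs = xs} x<g =
  trans (cong suc step) (sym (+-suc p _))
... | no x≮g
  rewrite filter-reject (_<? suc g) {xs = xs} (x≮g ∘ flip m<1+n∧m≢n⇒m<n x≢g) | filter-reject (_<? g) {xs = xs} x≮g =
  step

partsBelow-suc-∉ : ∀ {g} xs → g ∉ xs → partsBelow xs (suc g) ≡ partsBelow xs g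
partsBelow-suc-∉ [] _ = refl
partsBelow-suc-∉ (x ∷ xs) g∉x∷xs =
  partsBelow-suc-∷ xs 0 (g∉x∷xs ∘ here ∘ sym) (partsBelow-suc-∉ xs (g∉x∷xs ∘ there))

partsBelow-suc-∈ : ∀ {g xs} → AllPairs _≢_ xs → g ∈ xs → partsBelow xs (suc g) ≡ suc (partsBelow xs g)
partsBelow-suc-∈ {g} {_ ∷ xs} (g≢xs ∷ _) (here refl)
  rewrite filter-accept (_<? suc g) {xs = xs} (n<1+n g) | filter-reject (_<? g) {xs = xs} (n≮n g) =
  cong suc (partsBelow-suc-∉ xs (All¬⇒¬Any g≢xs))
partsBelow-suc-∈ {xs = _ ∷ xs} (x≢xs ∷ xs!) (there g∈xs) =
  partsBelow-suc-∷ xs 1 (All.lookup x≢xs g∈xs) (partsBelow-suc-∈ xs! g∈xs)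

countBelow+partsBelow : ∀ {λs} → AllPairs _≢_ λs → ∀ g → countBelow λs g + partsBelow λs g ≡ g
countBelow+partsBelow {λs} _ zero = partsBelow-zero λs
countBelow+partsBelow {λs} λs! (suc g) with g ∈? λs
... | yes g∈λs = begin
  countBelow λs (suc g) + partsBelow λs (suc g)
    ≡⟨ cong₂ _+_ (length-filter-upTo-suc-reject (λ s → ¬? (s ∈? λs)) (λ g∉λs → g∉λs g∈λs))
                 (partsBelow-suc-∈ λs! g∈λs) ⟩
  countBelow λs g + suc (partsBelow λs g) ≡⟨ +-suc _ _ ⟩
  suc (countBelow λs g + partsBelow λs g) ≡⟨ cong suc (countBelow+partsBelow λs! g) ⟩
  suc g                                   ∎
... | no g∉λs = begin
  countBelow λs (suc g) + partsBelow λs (suc g)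
    ≡⟨ cong₂ _+_ (length-filter-upTo-suc-accept (λ s → ¬? (s ∈? λs)) g∉λs) (partsBelow-suc-∉ λs g∉λs) ⟩
  suc (countBelow λs g + partsBelow λs g) ≡⟨ cong suc (countBelow+partsBelow λs! g) ⟩
  suc g                                   ∎

triangle : ℕ → ℕ
triangle zero = 0
triangle (suc t) = t + triangle t

sum-partsBelow : ∀ {xs} → AllPairs _<_ xs → sum (map (partsBelow xs) xs) ≡ triangle (length xs)
sum-partsBelow [] = refl
sum-partsBelow {x ∷ xs} (x<xs ∷ xs<) = begin
  partsBelow (x ∷ xs) x + sum (map (partsBelow (x ∷ xs)) xs)
    ≡⟨ cong₂ _+_ x-first (shift xs x<xs) ⟩
  length xs + sum (map (partsBelow xs) xs) ≡⟨ cong (length xs +_) (sum-partsBelow xs<) ⟩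
  length xs + triangle (length xs)         ∎
  where
  x-first : partsBelow (x ∷ xs) x ≡ 0
  x-first rewrite filter-reject (_<? x) {xs = xs} (n≮n x) = partsBelow-least x<xs
  shift : ∀ ws → All (x <_) ws → sum (map (partsBelow (x ∷ xs)) ws) ≡ length ws + sum (map (partsBelow xs) ws)
  shift [] [] = refl
  shift (w ∷ ws) (x<w ∷ x<ws) rewrite filter-accept (_<? w) {xs = xs} x<w =
    cong suc (trans (cong (partsBelow xs w +_) (shift ws x<ws)) (x∙yz≈y∙xz (partsBelow xs w) (length ws) _))

cells-rowsY : ∀ λs → cells (rowsY λs) ≡ sum (map (countBelow λs) λs)
cells-rowsY λs = trans (cong sum (reverse-map (countBelow λs) λs)) (sum-↭ (↭-reverse (map (countBelow λs) λs)))

cells-rowsY+triangle : ∀ {λs} → Linked _<_ λs → cells (rowsY λs) + triangle (length λs) ≡ ∣ λs ∣ₚ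
cells-rowsY+triangle {λs} λs< = begin
  cells (rowsY λs) + triangle (length λs)
    ≡⟨ cong₂ _+_ (cells-rowsY λs) (sym (sum-partsBelow λs<′)) ⟩
  sum (map (countBelow λs) λs) + sum (map (partsBelow λs) λs)
    ≡⟨ sum-map-+ (countBelow λs) (partsBelow λs) λs ⟩
  sum (map (λ g → countBelow λs g + partsBelow λs g) λs)
    ≡⟨ cong sum (map-cong (countBelow+partsBelow (AllPairs.map <⇒≢ λs<′)) λs) ⟩
  sum (map (λ g → g) λs) ≡⟨ cong sum (map-id λs) ⟩
  sum λs                 ∎
  where
  λs<′ : AllPairs _<_ λs
  λs<′ = Linked⇒AllPairs <-trans λs<

rowsY-decreasing : ∀ {λs} → Linked _<_ λs → AllPairs _≥_ (rowsY λs)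
rowsY-decreasing {λs} λs< =
  AllPairs.map⁺ (AllPairs.map (countBelow-mono λs ∘ <⇒≤) (AllPairs-reverse⁺ (Linked⇒AllPairs <-trans λs<)))

All-≤-largest : ∀ xs → All (_≤ largest xs) xs
All-≤-largest [] = []
All-≤-largest (x ∷ xs) =
  m≤m⊔n x (largest xs) ∷ All.map (λ y≤ → ≤-trans y≤ (m≤n⊔m x (largest xs))) (All-≤-largest xs)

countBelow-suc-largest : ∀ {λs} → 0 ∉ λs → countBelow λs (suc (largest λs)) ≡ suc (numMissing λs)
countBelow-suc-largest {λs} 0∉λs = begin
  length (filter P? (0 ∷ applyUpTo suc (largest λs)))   ≡⟨ cong length (filter-accept P? 0∉λs) ⟩
  suc (length (filter P? (applyUpTo suc (largest λs)))) ≡⟨ cong (suc ∘ length ∘ filter P?) (map-upTo suc (largest λs)) ⟨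
  suc (numMissing λs)                                   ∎
  where
  P? = λ s → ¬? (s ∈? λs)

numMissing+length≡largest : ∀ {λs} → IsDistinctPartition λs → numMissing λs + length λs ≡ largest λs
numMissing+length≡largest {λs} λ-distinct = suc-injective (begin
  suc (numMissing λs) + length λs
    ≡⟨ cong₂ _+_ (countBelow-suc-largest 0∉λs)
                 (cong length (filter-all (_<? _) (All.map s≤s (All-≤-largest λs)))) ⟨
  countBelow λs (suc (largest λs)) + partsBelow λs (suc (largest λs))
    ≡⟨ countBelow+partsBelow (AllPairs.map <⇒≢ (Linked⇒AllPairs <-trans increasing)) _ ⟩
  suc (largest λs) ∎)
  where
  open IsDistinctPartition λ-distinct
  0∉λs : 0 ∉ λs
  0∉λs = All¬⇒¬Any (All.map <⇒≢ positive)

length≡half-largest : ∀ {λs m} → IsDistinctPartition λs → largest λs ≡ 2 * m →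
                      numMissing λs ≡ largest λs / 2 → length λs ≡ m
length≡half-largest {λs} {m} λ-distinct L≡2m #M≡L/2 = +-cancelˡ-≡ m _ _ (begin
  m + length λs             ≡⟨ cong (_+ length λs) #M≡m ⟨
  numMissing λs + length λs ≡⟨ numMissing+length≡largest λ-distinct ⟩
  largest λs                ≡⟨ trans L≡2m (cong (m +_) (+-identityʳ m)) ⟩
  m + m                     ∎)
  where
  #M≡m : numMissing λs ≡ m
  #M≡m = trans #M≡L/2 (trans (cong (_/ 2) (trans L≡2m (*-comm 2 m))) (m*n/n≡m m 2))

cellsFromCol : ℕ → List ℕ → ℕ
cellsFromCol i rs = sum (map (_∸ i) rs)

cellsFromCol-suc : ∀ i rs → cellsFromCol i rs ≡ rowsWithCol i rs + cellsFromCol (suc i) rs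
cellsFromCol-suc i [] = refl
cellsFromCol-suc i (r ∷ rs) with i <? r
... | yes i<r = begin
  r ∸ i + cellsFromCol i rs
    ≡⟨ cong₂ _+_ (+-∸-assoc 1 i<r) (cellsFromCol-suc i rs) ⟩
  suc (r ∸ suc i) + (rowsWithCol i rs + cellsFromCol (suc i) rs)
    ≡⟨ cong suc (x∙yz≈y∙xz (r ∸ suc i) (rowsWithCol i rs) _) ⟩
  suc (rowsWithCol i rs + (r ∸ suc i + cellsFromCol (suc i) rs))
    ≡⟨ cong (λ ws → length ws + (r ∸ suc i + cellsFromCol (suc i) rs)) (filter-accept (i <?_) i<r) ⟨
  rowsWithCol i (r ∷ rs) + cellsFromCol (suc i) (r ∷ rs) ∎
... | no i≮r
  rewrite m≤n⇒m∸n≡0 (≮⇒≥ i≮r) | m≤n⇒m∸n≡0 (m≤n⇒m≤1+n (≮⇒≥ i≮r)) | filter-reject (i <?_) {xs = rs} i≮r =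
  cellsFromCol-suc i rs

cellsFromCol-≥ : ∀ {i rs} → All (_≤ i) rs → cellsFromCol i rs ≡ 0
cellsFromCol-≥ [] = refl
cellsFromCol-≥ (r≤i ∷ rs≤i) rewrite m≤n⇒m∸n≡0 r≤i = cellsFromCol-≥ rs≤i

diagHookSumFrom≡cellsFromCol : ∀ i {rs} → AllPairs _≥_ rs → diagHookSumFrom i rs ≡ cellsFromCol i rs
diagHookSumFrom≡cellsFromCol i [] = refl
diagHookSumFrom≡cellsFromCol i {r ∷ rs} (r≥rs ∷ rs≥) with i <? r
... | yes i<r = begin
  r ∸ suc i + rowsWithCol i rs + 1 + diagHookSumFrom (suc i) rs
    ≡⟨ cong (r ∸ suc i + rowsWithCol i rs + 1 +_) (diagHookSumFrom≡cellsFromCol (suc i) rs≥) ⟩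
  r ∸ suc i + rowsWithCol i rs + 1 + cellsFromCol (suc i) rs
    ≡⟨ rearrange (r ∸ suc i) (rowsWithCol i rs) _ ⟩
  suc (r ∸ suc i) + (rowsWithCol i rs + cellsFromCol (suc i) rs)
    ≡⟨ cong₂ _+_ (+-∸-assoc 1 i<r) (cellsFromCol-suc i rs) ⟨
  r ∸ i + cellsFromCol i rs ∎
  where
  rearrange : ∀ a b c → a + b + 1 + c ≡ suc a + (b + c)
  rearrange = solve-∀
... | no i≮r = begin
  diagHookSumFrom (suc i) rs ≡⟨ diagHookSumFrom≡cellsFromCol (suc i) rs≥ ⟩
  cellsFromCol (suc i) rs    ≡⟨ cellsFromCol-≥ (All.map m≤n⇒m≤1+n rs≤i) ⟩
  0                          ≡⟨ cong₂ _+_ (m≤n⇒m∸n≡0 r≤i) (cellsFromCol-≥ rs≤i) ⟨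
  r ∸ i + cellsFromCol i rs  ∎
  where
  r≤i : r ≤ i
  r≤i = ≮⇒≥ i≮r
  rs≤i : All (_≤ i) rs
  rs≤i = All.map (λ r′≤r → ≤-trans r′≤r r≤i) r≥rs

diagHookSum≡cells : ∀ {rs} → AllPairs _≥_ rs → diagHookSum rs ≡ cells rs
diagHookSum≡cells {rs} rs≥ = trans (diagHookSumFrom≡cellsFromCol 0 rs≥) (cong sum (map-id rs))

triangle-suc*2 : ∀ n → triangle (suc n) * 2 ≡ n * suc n
triangle-suc*2 zero = refl
triangle-suc*2 (suc n) = begin
  (suc n + triangle (suc n)) * 2     ≡⟨ *-distribʳ-+ 2 (suc n) (triangle (suc n)) ⟩
  suc n * 2 + triangle (suc n) * 2   ≡⟨ cong (suc n * 2 +_) (triangle-suc*2 n) ⟩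
  suc n * 2 + n * suc n              ≡⟨ expand n ⟩
  suc n * suc (suc n)                ∎
  where
  expand : ∀ n → suc n * 2 + n * suc n ≡ suc n * suc (suc n)
  expand = solve-∀

T≡triangle-suc : ∀ n → T n ≡ triangle (suc n)
T≡triangle-suc n = trans (cong (_/ 2) (sym (triangle-suc*2 n))) (m*n/n≡m (triangle (suc n)) 2)

T₂[2+m,2+m∸K+1]≡2m+K+triangle[m] : ∀ {m K} → K ≤ 2 + m →
  T₂ (2 + m) (2 + m ∸ K + 1) ≡ 2 * m + K + triangle m
T₂[2+m,2+m∸K+1]≡2m+K+triangle[m] {m} {K} K≤2+m = begin
  T (2 + m) ∸ (d + 1)                     ≡⟨ cong (_∸ (d + 1)) (T≡triangle-suc (2 + m)) ⟩
  (2 + m) + triangle (2 + m) ∸ (d + 1)    ≡⟨ cong (λ n → n + triangle (2 + m) ∸ (d + 1)) (m∸n+n≡m K≤2+m) ⟨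
  (d + K) + triangle (2 + m) ∸ (d + 1)    ≡⟨ cong (_∸ (d + 1)) (regroup d K m (triangle m)) ⟩
  (d + 1) + (2 * m + K + triangle m) ∸ (d + 1) ≡⟨ m+n∸m≡n (d + 1) _ ⟩
  2 * m + K + triangle m                  ∎
  where
  d = 2 + m ∸ K
  regroup : ∀ d K m t → (d + K) + (suc m + (m + t)) ≡ (d + 1) + (2 * m + K + t)
  regroup = solve-∀

2*[2+m]∸4≡2*m : ∀ m → 2 * (2 + m) ∸ 4 ≡ 2 * m
2*[2+m]∸4≡2*m m = trans (cong (_∸ 4) (*-distribˡ-+ 2 2 m)) (m+n∸m≡n 4 (2 * m))

proposition5p1 : (n k : ℕ) → 8 ≤ 2 * k → 2 * k ≤ n ∸ 2 →
    (λs : List ℕ) → InUbar (T₂ n (n ∸ 2 * k + 1)) λs → largest λs ≡ 2 * n ∸ 4 →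
    (cells (rowsY λs) ≡ 2 * n ∸ 4 + 2 * k) × (diagHookSum (rowsY λs) ≡ 2 * n ∸ 4 + 2 * k)
proposition5p1 zero k 8≤2k 2k≤0 _ _ _ = contradiction (≤-trans 8≤2k 2k≤0) λ ()
proposition5p1 (suc zero) k 8≤2k 2k≤0 _ _ _ = contradiction (≤-trans 8≤2k 2k≤0) λ ()
proposition5p1 (suc (suc m)) k _ 2k≤m λs (λ-distinct , ∣λ∣≡N , _ , _ , #M≡L/2) L≡2n-4 =
  #cells , trans (diagHookSum≡cells (rowsY-decreasing increasing)) #cells
  where
  open IsDistinctPartition λ-distinct
  t≡m : length λs ≡ m
  t≡m = length≡half-largest λ-distinct (trans L≡2n-4 (2*[2+m]∸4≡2*m m)) #M≡L/2
  #cells : cells (rowsY λs) ≡ 2 * (2 + m) ∸ 4 + 2 * k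
  #cells = +-cancelʳ-≡ (triangle m) _ _ (begin
    cells (rowsY λs) + triangle m           ≡⟨ cong (λ t → cells (rowsY λs) + triangle t) t≡m ⟨
    cells (rowsY λs) + triangle (length λs) ≡⟨ cells-rowsY+triangle increasing ⟩
    ∣ λs ∣ₚ                                 ≡⟨ ∣λ∣≡N ⟩
    T₂ (2 + m) (2 + m ∸ 2 * k + 1)          ≡⟨ T₂[2+m,2+m∸K+1]≡2m+K+triangle[m] (m≤n⇒m≤o+n 2 2k≤m) ⟩
    2 * m + 2 * k + triangle m              ≡⟨ cong (λ x → x + 2 * k + triangle m) (2*[2+m]∸4≡2*m m) ⟨
    2 * (2 + m) ∸ 4 + 2 * k + triangle m    ∎)
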